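{- Let $G$ be a finite simple undirected connected graph, $F$ a diagonal matching rule for $G$, and $M$ the prefix matching generated by $F$. Suppose that in $\Gamma^M$ there is a directed cycle $a_1\to b_1\to a_2\to\cdots\to a_p\to b_p\to a_{p+1}=a_1$, where each $a_i$ is a sequence of length $k+1$, each $b_i$ a sequence of length $k$, each edge $a_i\to b_i$ is an edge of $\Gamma$ with $b_i$ obtained from $a_i$ by deleting the entry of index $d_i$, and each edge $b_i\to a_{i+1}$ is a reversed matched edge with $a_{i+1}=(b_{i,0},\ldots,b_{i,c_i},u_i,b_{i,c_i+1},\ldots,b_{i,k-1})$ for some index $c_i$ and vertex $u_i$ (indices mod $p$). Then $d_i=c_i+1$ for all $i$.
   Context: $d$ is the shortest-path metric of $G$, $\ell(x_0,\ldots,x_k)=\sum_{i=0}^{k-1}d(x_i,x_{i+1})$. A "sequence" means a tuple $(x_0,\ldots,x_k)\in V(G)^{k+1}$ ($k\ge 0$) with $x_i\ne x_{i+1}$ for all $i$; we write $b_i=(b_{i,0},\ldots,b_{i,k-1})$. Let $\Gamma$ be the directed graph whose vertices are all sequences and with an edge $a\to b$ whenever $a=(x_0,\ldots,x_k)$ and $b=(x_0,\ldots,\hat x_i,\ldots,x_k)$ for some $1\le i\le k-1$ with $\ell(b)=\ell(a)$. A matching is a set of edges of $\Gamma$, no two sharing an endpoint; $\Gamma^M$ denotes $\Gamma$ with the edges of $M$ reversed. Relative to a matching, the matching state of a sequence $(x_0,\ldots,x_k)$ is: unmatched; insert$(i,v)$ if it is matched to $(x_0,\ldots,x_i,v,x_{i+1},\ldots,x_k)$;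 or delete$(i)$ if it is matched to $(x_0,\ldots,\hat x_i,\ldots,x_k)$. A prefix matching is a matching such that: if $(x_0,\ldots,x_k)$ has state insert$(i,v)$ (resp. delete$(i)$), then every sequence of the form $(x_0,\ldots,x_{i+1},y_{i+2},\ldots,y_{k'})$ has state insert$(i,v)$ (resp. delete$(i)$). A matching rule is a function $F$ from finite tuples of vertices to the symbols $\{\epsilon\}\cup\{\iota(v):v\in V(G)\}\cup\{\delta\}$. A prefix matching $M$ is generated by $F$ if for every sequence $(x_0,\ldots,x_k)$ ($k\ge1$) whose prefix $(x_0,\ldots,x_{k-1})$ is unmatched, its state is insert$(k-1,v)$ iff $F(x_0,\ldots,x_k)=\iota(v)$, and delete$(k-1)$ iff $F(x_0,\ldots,x_k)=\delta$. $F$ is valid if: (1) whenever $F(x_0,\ldots,x_k)=\iota(v)$, we have $d(x_{k-1},v)+d(v,x_k)=d(x_{k-1},x_k)$, $F(x_0,\ldots,x_{k-1},v)=\epsilon$ and $F(x_0,\ldots,x_{k-1},v,x_k)=\delta$; (2) whenever $F(x_0,\ldots,x_k)=\delta$, we have $d(x_{k-2},x_{k-1})+d(x_{k-1},x_k)=d(x_{k-2},x_k)$ and $F(x_0,\ldots,x_{k-2},x_k)=\iota(x_{k-1})$. A valid $F$ is diagonal if $F(x_0,\ldots,x_k)\ne\epsilon$ for every sequence $(x_0,\ldots,x_k)$ with unmatched prefix $(x_0,\ldots,x_{k-1})$ and $d(x_{k-1},x_k)\ge 2$. -}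

module Defs where

open import Data.Nat using (ℕ; zero; suc; _+_; _≤_; _<_; _∸_)
open import Data.Fin using (Fin)
open import Data.List using (List; []; _∷_; length; take; _∷ʳ_; _++_)
open import Data.List.Relation.Unary.Linked using (Linked)
open import Data.Product using (Σ; _×_; ∃)
open import Relation.Binary.PropositionalEquality using (_≡_; _≢_)
open import Relation.Nullary using (¬_)
open import Function.Bundles using (_⇔_)

record Graph (n : ℕ) : Set₁ where
  field
    Adj     : Fin n → Fin n → Set
    sym     : ∀ {x y} → Adj x y → Adj y x
    irrefl  : ∀ {x} → ¬ Adj x x
open Graph public

data Walk {n : ℕ} (G : Graph n) : Fin n → Fin n → ℕ → Set where
  here : ∀ {x} → Walk G x x 0
  step : ∀ {x z y m} → Adj G x z → Walk G z y m → Walk G x y (suc m)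

Connected : ∀ {n} → Graph n → Set
Connected G = ∀ x y → ∃ λ m → Walk G x y m

IsShortestPathMetric : ∀ {n} → Graph n → (Fin n → Fin n → ℕ) → Set
IsShortestPathMetric G d =
  ∀ x y → Walk G x y (d x y) × (∀ m → Walk G x y m → d x y ≤ m)

IsSeq : ∀ {n} → List (Fin n) → Set
IsSeq xs = 1 ≤ length xs × Linked _≢_ xs

ℓ : ∀ {n} → (Fin n → Fin n → ℕ) → List (Fin n) → ℕ
ℓ d []           = 0
ℓ d (x ∷ [])     = 0
ℓ d (x ∷ y ∷ r)  = d x y + ℓ d (y ∷ r)

del : ∀ {A : Set} → ℕ → List A → List A
del _       []      = []
del zero    (x ∷ r) = r
del (suc i) (x ∷ r) = x ∷ del i r

-- ins i v (x₀,…,x_k) = (x₀,…,x_i,v,x_{i+1},…,x_k)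
ins : ∀ {A : Set} → ℕ → A → List A → List A
ins _       v []      = v ∷ []
ins zero    v (x ∷ r) = x ∷ v ∷ r
ins (suc i) v (x ∷ r) = x ∷ ins i v r

ΓEdgeAt : ∀ {n} → (Fin n → Fin n → ℕ) → ℕ → List (Fin n) → List (Fin n) → Set
ΓEdgeAt d i a b =
  IsSeq a × IsSeq b × 1 ≤ i × suc i < length a × b ≡ del i a × ℓ d b ≡ ℓ d a

ΓEdge : ∀ {n} → (Fin n → Fin n → ℕ) → List (Fin n) → List (Fin n) → Set
ΓEdge d a b = ∃ λ i → ΓEdgeAt d i a b

Rel : ℕ → Set₁
Rel n = List (Fin n) → List (Fin n) → Set

IsMatching : ∀ {n} → (Fin n → Fin n → ℕ) → Rel n → Set
IsMatching d M =
  (∀ a b → M a b → ΓEdge d a b) ×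
  (∀ a b a′ b′ → M a b → M a′ b′ →
     (a ≡ a′ Data.Sum.⊎ a ≡ b′ Data.Sum.⊎ b ≡ a′ Data.Sum.⊎ b ≡ b′) →
     a ≡ a′ × b ≡ b′)
  where import Data.Sum

Unmatched : ∀ {n} → Rel n → List (Fin n) → Set
Unmatched M s = (∀ t → ¬ M s t) × (∀ t → ¬ M t s)

HasIns : ∀ {n} → Rel n → List (Fin n) → ℕ → Fin n → Set
HasIns M s i v = suc i < length s × M (ins i v s) s

HasDel : ∀ {n} → Rel n → List (Fin n) → ℕ → Set
HasDel M s i = i < length s × M s (del i s)

IsPrefixMatching : ∀ {n} → (Fin n → Fin n → ℕ) → Rel n → Set
IsPrefixMatching d M =
  IsMatching d M ×
  (∀ s i v → HasIns M s i v → ∀ t → IsSeq t →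
     take (2 + i) t ≡ take (2 + i) s → HasIns M t i v) ×
  (∀ s i → HasDel M s i → ∀ t → IsSeq t →
     take (2 + i) t ≡ take (2 + i) s → HasDel M t i)

data Sym (n : ℕ) : Set where
  ε : Sym n
  ι : Fin n → Sym n
  δ : Sym n

Rule : ℕ → Set
Rule n = List (Fin n) → Sym n

-- M is generated by F; a sequence (x₀,…,x_k), k ≥ 1, is written xs ∷ʳ x
GeneratedBy : ∀ {n} → Rel n → Rule n → Set
GeneratedBy M F =
  ∀ xs x → IsSeq (xs ∷ʳ x) → 1 ≤ length xs → Unmatched M xs →
    (∀ v → HasIns M (xs ∷ʳ x) (length xs ∸ 1) v ⇔ (F (xs ∷ʳ x) ≡ ι v)) ×
    (HasDel M (xs ∷ʳ x) (length xs ∸ 1) ⇔ (F (xs ∷ʳ x) ≡ δ))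

Valid : ∀ {n} → (Fin n → Fin n → ℕ) → Rule n → Set
Valid d F =
  (∀ xs y z v → F (xs ++ y ∷ z ∷ []) ≡ ι v →
     (d y v + d v z ≡ d y z) ×
     F (xs ++ y ∷ v ∷ []) ≡ ε ×
     F (xs ++ y ∷ v ∷ z ∷ []) ≡ δ) ×
  (∀ xs w y z → F (xs ++ w ∷ y ∷ z ∷ []) ≡ δ →
     (d w y + d y z ≡ d w z) ×
     F (xs ++ w ∷ z ∷ []) ≡ ι y)

-- diagonal (relative to the matching M under consideration)
Diagonal : ∀ {n} → (Fin n → Fin n → ℕ) → Rel n → Rule n → Set
Diagonal d M F =
  Valid d F ×
  (∀ xs x → IsSeq (xs ∷ʳ x) → 1 ≤ length xs → Unmatched M xs →
     ∀ y → Data.List.last xs ≡ Data.Maybe.just y → 2 ≤ d y x → F (xs ∷ʳ x) ≢ ε)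
  where import Data.Maybe

{-# OPTIONS --safe #-}
-- Fix an edge a → b of the cycle deleting index j, where b has state insert(c, u).
-- If j ≥ c + 2 the deletion leaves the first c + 2 entries untouched, so by the
-- prefix property a has state insert(c, u) too; but a is already matched downward,
-- being the endpoint of the previous reversed edge of the cycle.
-- If j ≤ c, every prefix of b of length ≤ c + 1 is unmatched; as ℓ is preserved,
-- the deleted vertex lies on a geodesic between its neighbours y and x, so
-- d(y, x) ≥ 2 and diagonality forces the prefix of b ending in y, x to be matched.
-- Hence j = c + 1.
module Submission where

open import Defs
open import Data.Nat using (ℕ; zero; suc; _≤_; _<_; _+_; z≤n; s≤s; s≤s⁻¹)
open import Data.Nat.Properties
  using (≤-trans; ≤-refl; ≤-antisym; <⇒≤; m≤n⇒m≤1+n; ≰⇒>; ≮⇒≥; 1+n≢n;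
         +-assoc; +-identityʳ; +-cancelˡ-≡; +-cancelʳ-≡; +-mono-≤; m≤n⇒m⊓n≡m; m⊓n≤m)
open import Data.Fin using (Fin)
open import Data.List using (List; []; _∷_; length; take; _∷ʳ_; _++_; last)
open import Data.List.Properties using (take-take; length-take; ∷-injectiveˡ; ∷-injectiveʳ)
open import Data.List.Relation.Unary.Linked using (Linked; []; [-]; _∷_)
import Data.List.Relation.Unary.Linked as Linked
open import Data.Maybe using (just)
open import Data.Product using (_×_; _,_; proj₁; proj₂; ∃; ∃₂)
open import Data.Sum using (inj₁; inj₂)
open import Data.Empty using (⊥)
open import Function.Bundles using (Equivalence)
open import Relation.Binary.PropositionalEquality
  using (_≡_; _≢_; refl; trans; cong; subst; module ≡-Reasoning)
import Relation.Binary.PropositionalEquality as ≡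
open import Relation.Nullary using (¬_; contradiction)

private
  variable
    A : Set

length-del : ∀ i (xs : List A) → i < length xs → suc (length (del i xs)) ≡ length xs
length-del zero    (x ∷ xs) _          = refl
length-del (suc i) (x ∷ xs) (s≤s i<n) = cong suc (length-del i xs i<n)

ins-del : ∀ i (xs : List A) → suc i < length xs → ∃ λ v → ins i v (del (suc i) xs) ≡ xs
ins-del zero    (x ∷ y ∷ xs) _           = y , refl
ins-del zero    (x ∷ [])     (s≤s ())
ins-del (suc i) (x ∷ xs)     (s≤s i+1<n) = let v , eq = ins-del i xs i+1<n in v , cong (x ∷_) eq

take-del : ∀ m i (xs : List A) → m ≤ i → take m (del i xs) ≡ take m xs
take-del zero    i       xs       _       = refl
take-del (suc m) (suc i) []       _       = refl
take-del (suc m) (suc i) (x ∷ xs) (s≤s m≤i) = cong (x ∷_) (take-del m i xs m≤i)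

length-take≤ : ∀ m (xs : List A) → length (take m xs) ≤ m
length-take≤ m xs = subst (_≤ m) (≡.sym (length-take m xs)) (m⊓n≤m m (length xs))

-- The two insertions can only agree if v equals its right neighbour in ins i v xs.
ins≢ins : ∀ {i j} (v u : A) xs → i < j → suc j < length xs →
          Linked _≢_ (ins i v xs) → ins i v xs ≢ ins j u xs
ins≢ins {i = zero}  {suc zero}    v u (x ∷ y ∷ xs) _ _ (_ ∷ v≢y ∷ _) eq = v≢y (∷-injectiveˡ (∷-injectiveʳ eq))
ins≢ins {i = zero}  {suc (suc j)} v u (x ∷ y ∷ xs) _ _ (_ ∷ v≢y ∷ _) eq = v≢y (∷-injectiveˡ (∷-injectiveʳ eq))
ins≢ins {i = zero}  {suc j}       v u (x ∷ [])     _ (s≤s ()) _ _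
ins≢ins {i = suc i} {suc j} v u (x ∷ xs) (s≤s i<j) (s≤s j+1<n) linked eq =
  ins≢ins v u xs i<j j+1<n (Linked.tail linked) (∷-injectiveʳ eq)

split-around : ∀ j (xs : List A) → 1 ≤ j → suc j < length xs →
  ∃₂ λ pre y → ∃₂ λ z x → ∃ λ rest →
    xs ≡ pre ++ y ∷ z ∷ x ∷ rest × j ≡ suc (length pre)
split-around (suc zero)    (y ∷ z ∷ x ∷ rest) _ _ = [] , y , z , x , rest , refl , refl
split-around (suc zero)    (_ ∷ [])     _ (s≤s ())
split-around (suc zero)    (_ ∷ _ ∷ []) _ (s≤s (s≤s ()))
split-around (suc (suc j)) (w ∷ xs) _ (s≤s j+2<n) =
  let pre , y , z , x , rest , xs≡ , j≡ = split-around (suc j) xs (s≤s z≤n) j+2<n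
  in w ∷ pre , y , z , x , rest , cong (w ∷_) xs≡ , cong suc j≡

del-++ : ∀ (pre : List A) y z x rest →
         del (suc (length pre)) (pre ++ y ∷ z ∷ x ∷ rest) ≡ pre ++ y ∷ x ∷ rest
del-++ []        y z x rest = refl
del-++ (w ∷ pre) y z x rest = cong (w ∷_) (del-++ pre y z x rest)

take-++-∷ : ∀ (pre : List A) y rest → take (suc (length pre)) (pre ++ y ∷ rest) ≡ pre ∷ʳ y
take-++-∷ []        y rest = refl
take-++-∷ (w ∷ pre) y rest = cong (w ∷_) (take-++-∷ pre y rest)

take-++-∷-∷ : ∀ (pre : List A) y x rest →
              take (2 + length pre) (pre ++ y ∷ x ∷ rest) ≡ pre ∷ʳ y ∷ʳ x
take-++-∷-∷ []        y x rest = refl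
take-++-∷-∷ (w ∷ pre) y x rest = cong (w ∷_) (take-++-∷-∷ pre y x rest)

0<length-∷ʳ : ∀ (xs : List A) x → 0 < length (xs ∷ʳ x)
0<length-∷ʳ []       x = s≤s z≤n
0<length-∷ʳ (_ ∷ xs) x = s≤s z≤n

last-∷ʳ : ∀ (xs : List A) x → last (xs ∷ʳ x) ≡ just x
last-∷ʳ []           x = refl
last-∷ʳ (_ ∷ [])     x = refl
last-∷ʳ (_ ∷ y ∷ xs) x = last-∷ʳ (y ∷ xs) x

Linked-take⁺ : ∀ {R : A → A → Set} m {xs} → Linked R xs → Linked R (take m xs)
Linked-take⁺ zero          _            = []
Linked-take⁺ (suc m)       []           = []
Linked-take⁺ (suc zero)    [-]          = [-]
Linked-take⁺ (suc (suc m)) [-]          = [-]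
Linked-take⁺ (suc zero)    (_ ∷ _)      = [-]
Linked-take⁺ (suc (suc m)) (Rxy ∷ rest) = Rxy ∷ Linked-take⁺ (suc m) rest

Linked-++⁻ʳ : ∀ {R : A → A → Set} (xs : List A) {ys} → Linked R (xs ++ ys) → Linked R ys
Linked-++⁻ʳ []       linked = linked
Linked-++⁻ʳ (_ ∷ xs) linked = Linked-++⁻ʳ xs (Linked.tail linked)

module _ {n} (d : Fin n → Fin n → ℕ) where

  ℓ-++-∷ : ∀ (pre : List (Fin n)) y rest → ℓ d (pre ++ y ∷ rest) ≡ ℓ d (pre ∷ʳ y) + ℓ d (y ∷ rest)
  ℓ-++-∷ []             y rest = refl
  ℓ-++-∷ (w ∷ [])       y rest = cong (_+ ℓ d (y ∷ rest)) (≡.sym (+-identityʳ (d w y)))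
  ℓ-++-∷ (w ∷ w′ ∷ pre) y rest =
    trans (cong (d w w′ +_) (ℓ-++-∷ (w′ ∷ pre) y rest)) (≡.sym (+-assoc (d w w′) _ _))

  ℓ-del≡⇒between : ∀ pre y z x rest →
    ℓ d (pre ++ y ∷ x ∷ rest) ≡ ℓ d (pre ++ y ∷ z ∷ x ∷ rest) → d y z + d z x ≡ d y x
  ℓ-del≡⇒between pre y z x rest ℓ≡ =
    ≡.sym (+-cancelʳ-≡ L (d y x) _ (+-cancelˡ-≡ P _ _ (begin
      P + (d y x + L)               ≡⟨ ≡.sym (ℓ-++-∷ pre y (x ∷ rest)) ⟩
      ℓ d (pre ++ y ∷ x ∷ rest)     ≡⟨ ℓ≡ ⟩
      ℓ d (pre ++ y ∷ z ∷ x ∷ rest) ≡⟨ ℓ-++-∷ pre y (z ∷ x ∷ rest) ⟩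
      P + (d y z + (d z x + L))     ≡⟨ cong (P +_) (≡.sym (+-assoc (d y z) (d z x) L)) ⟩
      P + (d y z + d z x + L)       ∎)))
    where
    open ≡-Reasoning
    P L : ℕ
    P = ℓ d (pre ∷ʳ y)
    L = ℓ d (x ∷ rest)

0<d : ∀ {n} {G : Graph n} {d} → IsShortestPathMetric G d → ∀ {x y} → x ≢ y → 0 < d x y
0<d {d = d} sp {x} {y} x≢y with d x y | proj₁ (sp x y)
... | zero  | here = contradiction refl x≢y
... | suc _ | _    = s≤s z≤n

module Matching {n} {d : Fin n → Fin n → ℕ} {M : Rel n} (matching : IsMatching d M) where

  source-Linked : ∀ {a b} → M a b → Linked _≢_ a
  source-Linked m = let _ , (_ , linked) , _ = proj₁ matching _ _ m in linked

  length-source : ∀ {a b} → M a b → length a ≡ suc (length b)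
  length-source {a} m with proj₁ matching _ _ m
  ... | i , _ , _ , _ , i+1<n , refl , _ = ≡.sym (length-del i a (<⇒≤ i+1<n))

  target-not-source : ∀ {a b c} → M a b → ¬ M b c
  target-not-source mab mbc =
    let b≡a , _ = proj₂ matching _ _ _ _ mbc mab (inj₂ (inj₁ refl))
    in 1+n≢n (trans (≡.sym (length-source mab)) (cong length (≡.sym b≡a)))

  target-unique : ∀ {a a′ b} → M a b → M a′ b → a ≡ a′
  target-unique mab ma′b = proj₁ (proj₂ matching _ _ _ _ mab ma′b (inj₂ (inj₂ (inj₂ refl))))

  M⇒HasDel : ∀ {s t} → M s t → ∃ λ i → suc i < length s × HasDel M s i
  M⇒HasDel m with proj₁ matching _ _ m
  ... | i , _ , _ , _ , i+1<n , refl , _ = i , i+1<n , <⇒≤ i+1<n , m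

  M⇒HasIns : ∀ {t s} → M t s → ∃₂ λ i v → HasIns M s i v
  M⇒HasIns {t} m with proj₁ matching _ _ m
  ... | suc i , _ , _ , _ , i+2<n , refl , _ =
    let v , t≡ = ins-del i t (<⇒≤ i+2<n)
    in i , v ,
       s≤s⁻¹ (subst (suc (suc i) <_) (≡.sym (length-del (suc i) t (<⇒≤ i+2<n))) i+2<n) ,
       subst (λ r → M r _) (≡.sym t≡) m

module Prefix {n} {d : Fin n → Fin n → ℕ} {M : Rel n} (prefix : IsPrefixMatching d M) where

  open Matching (proj₁ prefix) public

  HasIns-prefix : ∀ {s i v} → HasIns M s i v → ∀ {t} → IsSeq t →
                  take (2 + i) t ≡ take (2 + i) s → HasIns M t i v
  HasIns-prefix hasIns = proj₁ (proj₂ prefix) _ _ _ hasIns _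

  HasDel-prefix : ∀ {s i} → HasDel M s i → ∀ {t} → IsSeq t →
                  take (2 + i) t ≡ take (2 + i) s → HasDel M t i
  HasDel-prefix hasDel = proj₂ (proj₂ prefix) _ _ hasDel _

  -- A matched edge at a short prefix of b would propagate to b itself, where it
  -- clashes with the edge inserting at index c.
  HasIns⇒take-unmatched : ∀ {b c u} → IsSeq b → HasIns M b c u →
                          ∀ m → m ≤ suc c → Unmatched M (take m b)
  HasIns⇒take-unmatched {b} {c} {u} seq (c+1<n , mb) m m≤c+1 = no-out , no-in
    where
    take-prefix : ∀ {k} → k ≤ length (take m b) → take k b ≡ take k (take m b)
    take-prefix k≤ = ≡.sym (trans (take-take _ m b)
      (cong (λ k → take k b) (m≤n⇒m⊓n≡m (≤-trans k≤ (length-take≤ m b)))))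

    no-out : ∀ t → ¬ M (take m b) t
    no-out _ m′ =
      let i , i+1<n , hasDel = M⇒HasDel m′
      in target-not-source mb (proj₂ (HasDel-prefix hasDel seq (take-prefix i+1<n)))

    no-in : ∀ t → ¬ M t (take m b)
    no-in _ m′ =
      let i , v , hasIns = M⇒HasIns m′
          i+1<n = proj₁ hasIns
          _ , mb′ = HasIns-prefix hasIns seq (take-prefix i+1<n)
          i<c = s≤s⁻¹ (≤-trans (≤-trans i+1<n (length-take≤ m b)) m≤c+1)
      in ins≢ins v u b i<c c+1<n (source-Linked mb′) (target-unique mb′ mb)

  del≤suc-ins : ∀ {j a b c u y} → ΓEdgeAt d j a b → HasIns M b c u → M a y → j ≤ suc c
  del≤suc-ins {j} {a} {c = c} (seqA , _ , _ , _ , refl , _) hasIns ma = ≮⇒≥ λ c+1<j →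
    target-not-source (proj₂ (HasIns-prefix hasIns seqA (≡.sym (take-del (2 + c) j a c+1<j)))) ma

module _ {n} {d : Fin n → Fin n → ℕ} {M : Rel n} {F : Rule n}
         (diagonal : Diagonal d M F) (generated : GeneratedBy M F) where

  diagonal-extension-matched : ∀ xs y x → IsSeq (xs ∷ʳ y ∷ʳ x) → Unmatched M (xs ∷ʳ y) →
                               2 ≤ d y x → ¬ Unmatched M (xs ∷ʳ y ∷ʳ x)
  diagonal-extension-matched xs y x seq unmatched 2≤d (no-out , no-in) = by-symbol _ refl
    where
    nonempty : 0 < length (xs ∷ʳ y)
    nonempty = 0<length-∷ʳ xs y

    by-symbol : ∀ s → F (xs ∷ʳ y ∷ʳ x) ≡ s → ⊥
    by-symbol ε     eq = proj₂ diagonal (xs ∷ʳ y) x seq nonempty unmatched y (last-∷ʳ xs y) 2≤d eq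
    by-symbol (ι v) eq = no-in _ (proj₂ (Equivalence.from
                           (proj₁ (generated (xs ∷ʳ y) x seq nonempty unmatched) v) eq))
    by-symbol δ     eq = no-out _ (proj₂ (Equivalence.from
                           (proj₂ (generated (xs ∷ʳ y) x seq nonempty unmatched)) eq))

module _ {n} {G : Graph n} {d : Fin n → Fin n → ℕ} {M : Rel n} {F : Rule n}
         (shortest : IsShortestPathMetric G d) (diagonal : Diagonal d M F)
         (generated : GeneratedBy M F) (prefix : IsPrefixMatching d M) where

  open Prefix prefix

  ¬geodesic-deletion-before-insertion : ∀ {b c u} pre y z x rest →
    b ≡ pre ++ y ∷ x ∷ rest → Linked _≢_ (y ∷ z ∷ x ∷ rest) → IsSeq b →
    ℓ d b ≡ ℓ d (pre ++ y ∷ z ∷ x ∷ rest) → HasIns M b c u → ¬ suc (length pre) ≤ c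
  ¬geodesic-deletion-before-insertion {c = c} pre y z x rest refl (y≢z ∷ z≢x ∷ _) seq ℓ≡ hasIns j≤c =
    diagonal-extension-matched {F = F} diagonal generated pre y x seq′
      (subst (Unmatched M) (take-++-∷ pre y (x ∷ rest)) (unmatched (m≤n⇒m≤1+n j≤c)))
      2≤d
      (subst (Unmatched M) (take-++-∷-∷ pre y x rest) (unmatched (s≤s j≤c)))
    where
    unmatched : ∀ {m} → m ≤ suc c → Unmatched M (take m (pre ++ y ∷ x ∷ rest))
    unmatched = HasIns⇒take-unmatched seq hasIns _

    2≤d : 2 ≤ d y x
    2≤d = subst (2 ≤_) (ℓ-del≡⇒between d pre y z x rest ℓ≡)
                (+-mono-≤ (0<d shortest y≢z) (0<d shortest z≢x))

    seq′ : IsSeq (pre ∷ʳ y ∷ʳ x)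
    seq′ = 0<length-∷ʳ (pre ∷ʳ y) x ,
           subst (Linked _≢_) (take-++-∷-∷ pre y x rest) (Linked-take⁺ (2 + length pre) (proj₂ seq))

  ins<del : ∀ {j a b c u} → ΓEdgeAt d j a b → HasIns M b c u → c < j
  ins<del {j} {a} (seqA , seqB , 1≤j , j+1<n , b≡ , ℓ≡) hasIns
    with split-around j a 1≤j j+1<n
  ... | pre , y , z , x , rest , refl , refl =
    ≰⇒> (¬geodesic-deletion-before-insertion pre y z x rest
          (trans b≡ (del-++ pre y z x rest)) (Linked-++⁻ʳ pre (proj₂ seqA)) seqB ℓ≡ hasIns)

cycle-sources-matched : ∀ (R : A → A → Set) {a b : ℕ → A} p → 1 ≤ p → a p ≡ a 0 →
  (∀ i → i < p → R (a (suc i)) (b i)) → ∀ i → i < p → ∃ (R (a i))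
cycle-sources-matched R {b = b} (suc p) _ ap≡a0 edge zero _ =
  b p , subst (λ s → R s (b p)) ap≡a0 (edge p ≤-refl)
cycle-sources-matched R {b = b} p _ _ edge (suc i) i+1<p = b i , edge i (<⇒≤ i+1<p)

lemma3p11 : ∀ {n} (G : Graph n) → Connected G →
    (d : Fin n → Fin n → ℕ) → IsShortestPathMetric G d →
    (F : Rule n) → (M : Rel n) →
    Diagonal d M F → IsPrefixMatching d M → GeneratedBy M F →
    (p k : ℕ) → 1 ≤ p →
    (a b : ℕ → List (Fin n)) (dᵢ cᵢ : ℕ → ℕ) (u : ℕ → Fin n) →
    a p ≡ a 0 →
    (∀ i → i < p →
       length (a i) ≡ suc k × length (b i) ≡ k ×
       ΓEdgeAt d (dᵢ i) (a i) (b i) × ¬ M (a i) (b i) ×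
       HasIns M (b i) (cᵢ i) (u i) ×
       a (suc i) ≡ ins (cᵢ i) (u i) (b i)) →
    ∀ i → i < p → dᵢ i ≡ suc (cᵢ i)
lemma3p11 G _ d shortest F M diagonal prefix generated p k 1≤p a b dᵢ cᵢ u ap≡a0 cycle i i<p =
  let _ , _ , edge , _ , hasIns , _ = cycle i i<p
      _ , a-matched = cycle-sources-matched M p 1≤p ap≡a0 matched i i<p
  in ≤-antisym (Prefix.del≤suc-ins prefix edge hasIns a-matched)
               (ins<del {F = F} shortest diagonal generated prefix edge hasIns)
  where
  matched : ∀ j → j < p → M (a (suc j)) (b j)
  matched j j<p =
    let _ , _ , _ , _ , (_ , m) , a≡ = cycle j j<p
    in subst (λ s → M s (b j)) (≡.sym a≡) m
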